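{- Let $k$ be a positive integer. If there exists a $k$-regular graph $H$ containing a hamiltonian cycle $\mathfrak{h}_H$ such that $H$ has no $\mathfrak{h}_H$-independent dominating set, then there exist infinitely many $k$-regular graphs $G$ containing a hamiltonian cycle $\mathfrak{h}$ such that $G$ has no $\mathfrak{h}$-independent dominating set.
   Context: For a graph $G$ with a hamiltonian cycle $\mathfrak{h}$, an $\mathfrak{h}$-independent dominating set of $G$ is a vertex set $S \subseteq V(G)$ that is an independent set in the graph $(V(G), E(\mathfrak{h}))$ and a dominating set in the graph $(V(G), E(G)\setminus E(\mathfrak{h}))$. -}

module Defs where

open import Data.Nat using (ℕ; zero; suc; _≤_; _<_)
open import Data.Fin using (Fin; toℕ)
open import Data.Fin.Subset using (Subset; _∈_; _∉_; ∣_∣)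
open import Data.Fin.Permutation using (Permutation′; _⟨$⟩ʳ_)
open import Data.Product using (Σ; ∃; _×_)
open import Data.Sum using (_⊎_)
open import Relation.Binary.PropositionalEquality using (_≡_)
open import Relation.Nullary using (¬_)

record Graph (n : ℕ) : Set where
  field
    nbr    : Fin n → Subset n
    sym    : ∀ u v → v ∈ nbr u → u ∈ nbr v
    irrefl : ∀ u → u ∉ nbr u
open Graph public

Regular : ∀ {n} → ℕ → Graph n → Set
Regular k G = ∀ u → ∣ nbr G u ∣ ≡ k

Next : ℕ → ℕ → ℕ → Set
Next n a b = suc a ≡ b ⊎ (suc a ≡ n × b ≡ 0)

-- The edge relation of the cycle through all vertices in the order given by
-- ord (ord maps each vertex to its position 0..n-1 on the cycle).
CycEdge : ∀ {n} → Permutation′ n → Fin n → Fin n → Set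
CycEdge {n} ord u v =
  Next n (toℕ (ord ⟨$⟩ʳ u)) (toℕ (ord ⟨$⟩ʳ v)) ⊎ Next n (toℕ (ord ⟨$⟩ʳ v)) (toℕ (ord ⟨$⟩ʳ u))

record HamCycle {n : ℕ} (G : Graph n) : Set where
  field
    ord    : Permutation′ n
    length : 3 ≤ n
    edges  : ∀ u v → CycEdge ord u v → v ∈ nbr G u
open HamCycle public

IndepDom : ∀ {n} (G : Graph n) → HamCycle G → Subset n → Set
IndepDom {n} G h S =
  (∀ u v → u ∈ S → v ∈ S → ¬ CycEdge (ord h) u v) ×
  (∀ v → v ∈ S ⊎ (∃ λ u → u ∈ S × v ∈ nbr G u × ¬ CycEdge (ord h) u v))

NoIndepDom : ∀ {n} (G : Graph n) → HamCycle G → Set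
NoIndepDom G h = ¬ (∃ λ S → IndepDom G h S)

-- Let xy be the closing edge of the hamiltonian cycle h of H (x last, y first).  Take two
-- copies of H − xy and add the edges x₀y₁ and x₁y₀: this 2-lift of H is again k-regular, and
-- running through copy 0 and then copy 1 is a hamiltonian cycle of it.  Since the new edges lie
-- on that cycle they never dominate, so an independent dominating set S of the lift restricts,
-- in each copy, to one of H unless the restriction contains both x and y; this cannot happen in
-- both copies, because x₀ and y₁ are consecutive on the cycle.  Iterating the doubling gives
-- arbitrarily large examples.

module Submission where

open import Defs
open import Data.Bool using (Bool; true)
open import Data.Empty using (⊥)
open import Data.Fin using (Fin; toℕ; splitAt; join; _↑ˡ_; _↑ʳ_)
open import Data.Fin.Permutation using (Permutation′; _⟨$⟩ʳ_)
open import Data.Fin.Properties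
  using (+↔⊎; toℕ<n; splitAt-↑ˡ; splitAt-↑ʳ; splitAt⁻¹-↑ˡ; splitAt⁻¹-↑ʳ; toℕ-↑ˡ; toℕ-↑ʳ)
open import Data.Fin.Subset using (Subset; _∈_; _∉_; _⊆_; _─_; ∣_∣; inside; outside)
open import Data.Fin.Subset.Properties using (p─q⊆p; x∈p∧x∉q⇒x∈p─q; drop-∷-⊆)
open import Data.Nat using (ℕ; zero; suc; _+_; _≤_; _<_; z≤n; s≤s; _≟_)
open import Data.Nat.Properties
  using ( +-comm; +-suc; +-identityʳ; +-cancelˡ-≡; m≤m+n; m<m+n; m+n≡0⇒m≡0; m≤n⇒m≤1+n
        ; <⇒≢; <⇒≱; ≤-<-trans; ≤-trans; suc-injective)
open import Data.Product using (Σ; ∃; _×_; _,_; proj₁; proj₂)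
open import Data.Sum as Sum using (_⊎_; inj₁; inj₂; [_,_]′)
open import Data.Sum.Function.Propositional using (_⊎-↔_)
open import Data.Vec using ([]; _∷_; _++_; tabulate; lookup; here; there)
open import Data.Vec.Properties using (lookup∘tabulate; []=⇒lookup; lookup⇒[]=)
open import Function using (_∘_)
open import Function.Properties.Inverse using (↔-trans; ↔-sym)
open import Relation.Binary.PropositionalEquality
  using (_≡_; _≢_; refl; cong; trans; subst; subst₂) renaming (sym to ≡-sym)
open import Relation.Nullary using (¬_; Dec; yes; does; contradiction)
open import Relation.Nullary.Decidable using (dec-true; _×-dec_; _⊎-dec_)

private
  variable
    m n : ℕ

∣p++q∣≡∣p∣+∣q∣ : (p : Subset m) (q : Subset n) → ∣ p ++ q ∣ ≡ ∣ p ∣ + ∣ q ∣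
∣p++q∣≡∣p∣+∣q∣ []            q = refl
∣p++q∣≡∣p∣+∣q∣ (inside  ∷ p) q = cong suc (∣p++q∣≡∣p∣+∣q∣ p q)
∣p++q∣≡∣p∣+∣q∣ (outside ∷ p) q = ∣p++q∣≡∣p∣+∣q∣ p q

q⊆p⇒∣p─q∣+∣q∣≡∣p∣ : (p q : Subset n) → q ⊆ p → ∣ p ─ q ∣ + ∣ q ∣ ≡ ∣ p ∣
q⊆p⇒∣p─q∣+∣q∣≡∣p∣ []            []            _   = refl
q⊆p⇒∣p─q∣+∣q∣≡∣p∣ (inside  ∷ p) (outside ∷ q) q⊆p =
  cong suc (q⊆p⇒∣p─q∣+∣q∣≡∣p∣ p q (drop-∷-⊆ q⊆p))
q⊆p⇒∣p─q∣+∣q∣≡∣p∣ (outside ∷ p) (outside ∷ q) q⊆p = q⊆p⇒∣p─q∣+∣q∣≡∣p∣ p q (drop-∷-⊆ q⊆p)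
q⊆p⇒∣p─q∣+∣q∣≡∣p∣ (inside  ∷ p) (inside  ∷ q) q⊆p =
  trans (+-suc ∣ p ─ q ∣ ∣ q ∣) (cong suc (q⊆p⇒∣p─q∣+∣q∣≡∣p∣ p q (drop-∷-⊆ q⊆p)))
q⊆p⇒∣p─q∣+∣q∣≡∣p∣ (outside ∷ p) (inside  ∷ q) q⊆p with () ← q⊆p here

x∈p─q⇒x∉q : ∀ {x : Fin n} (p q : Subset n) → x ∈ p ─ q → x ∉ q
x∈p─q⇒x∉q (_ ∷ p) (_ ∷ q) (there x∈p─q) (there x∈q) = x∈p─q⇒x∉q p q x∈p─q x∈q

↑ˡ∈++⁺ : ∀ {x : Fin m} {p : Subset m} (q : Subset n) → x ∈ p → x ↑ˡ n ∈ p ++ q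
↑ˡ∈++⁺ q here        = here
↑ˡ∈++⁺ q (there x∈p) = there (↑ˡ∈++⁺ q x∈p)

↑ˡ∈++⁻ : ∀ {x : Fin m} (p : Subset m) {q : Subset n} → x ↑ˡ n ∈ p ++ q → x ∈ p
↑ˡ∈++⁻ {x = Fin.zero}  (_ ∷ p) here           = here
↑ˡ∈++⁻ {x = Fin.suc x} (_ ∷ p) (there x∈p++q) = there (↑ˡ∈++⁻ p x∈p++q)

↑ʳ∈++⁺ : ∀ {x : Fin n} (p : Subset m) {q : Subset n} → x ∈ q → m ↑ʳ x ∈ p ++ q
↑ʳ∈++⁺ []      x∈q = x∈q
↑ʳ∈++⁺ (_ ∷ p) x∈q = there (↑ʳ∈++⁺ p x∈q)

↑ʳ∈++⁻ : ∀ {x : Fin n} (p : Subset m) {q : Subset n} → m ↑ʳ x ∈ p ++ q → x ∈ q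
↑ʳ∈++⁻ []      x∈q         = x∈q
↑ʳ∈++⁻ (_ ∷ p) (there x∈q) = ↑ʳ∈++⁻ p x∈q

∈-tabulate⁺ : ∀ {x : Fin n} (f : Fin n → Bool) → f x ≡ inside → x ∈ tabulate f
∈-tabulate⁺ {x = x} f fx≡inside = lookup⇒[]= x (tabulate f) (trans (lookup∘tabulate f x) fx≡inside)

∈-tabulate⁻ : ∀ {x : Fin n} (f : Fin n → Bool) → x ∈ tabulate f → f x ≡ inside
∈-tabulate⁻ {x = x} f x∈tf = trans (≡-sym (lookup∘tabulate f x)) ([]=⇒lookup x∈tf)

dec-true⁻ : ∀ {A : Set} (a? : Dec A) → does a? ≡ true → A
dec-true⁻ (yes a) _ = a

data Sheet : Set where
  lower upper : Sheet

other : Sheet → Sheet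
other lower = upper
other upper = lower

offset : ℕ → Sheet → ℕ
offset n lower = 0
offset n upper = n

Wrap : ℕ → ℕ → ℕ → Set
Wrap n x y = suc x ≡ n × y ≡ 0

next-along : ∀ n s {x y} → suc x ≡ y → Next (n + n) (offset n s + x) (offset n s + y)
next-along n lower     e = inj₁ e
next-along n upper {x} e = inj₁ (trans (≡-sym (+-suc n x)) (cong (n +_) e))

next-across : ∀ n s {x y} → Wrap n x y → Next (n + n) (offset n s + x) (offset n (other s) + y)
next-across n lower     (sx≡n , refl) = inj₁ (trans sx≡n (≡-sym (+-identityʳ n)))
next-across n upper {x} (sx≡n , refl) = inj₂ (trans (≡-sym (+-suc n x)) (cong (n +_) sx≡n) , refl)

1+x≢n+n : ∀ {n x} → x < n → suc x ≢ n + n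
1+x≢n+n {n} x<n = <⇒≢ (≤-<-trans x<n (m<m+n n (≤-<-trans z≤n x<n)))

next-double⁻ : ∀ n s t {x y} → x < n → y < n → Next (n + n) (offset n s + x) (offset n t + y) →
  (t ≡ s × suc x ≡ y) ⊎ (t ≡ other s × Wrap n x y)
next-double⁻ n lower lower x<n y<n (inj₁ e)       = inj₁ (refl , e)
next-double⁻ n lower lower x<n y<n (inj₂ (e , _)) = contradiction e (1+x≢n+n x<n)
next-double⁻ n upper upper {x} x<n y<n (inj₁ e)   = inj₁ (refl , +-cancelˡ-≡ n _ _ (trans (+-suc n x) e))
next-double⁻ n upper upper x<n y<n (inj₂ (_ , e)) =
  contradiction (m+n≡0⇒m≡0 n e) (<⇒≢ (≤-<-trans z≤n y<n) ∘ ≡-sym)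
next-double⁻ n lower upper {x} {zero} x<n y<n (inj₁ e) = inj₂ (refl , trans e (+-identityʳ n) , refl)
next-double⁻ n lower upper {x} {suc y} x<n y<n (inj₁ e) =
  contradiction (subst (n ≤_) (≡-sym (suc-injective (trans e (+-suc n y)))) (m≤m+n n y)) (<⇒≱ x<n)
next-double⁻ n lower upper x<n y<n (inj₂ (e , _)) = contradiction e (1+x≢n+n x<n)
next-double⁻ n upper lower {x} x<n y<n (inj₁ e) =
  contradiction (subst (n ≤_) e (m≤n⇒m≤1+n (m≤m+n n x))) (<⇒≱ y<n)
next-double⁻ n upper lower {x} x<n y<n (inj₂ (e , y≡0)) =
  inj₂ (refl , +-cancelˡ-≡ n _ _ (trans (+-suc n x) e) , y≡0)

module Sheets (m : ℕ) where

  at : Sheet → Fin m → Fin (m + m)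
  at lower a = a ↑ˡ m
  at upper a = m ↑ʳ a

  data AtView : Fin (m + m) → Set where
    at-view : ∀ s a → AtView (at s a)

  view : ∀ u → AtView u
  view u with splitAt m u in eq
  ... | inj₁ a = subst AtView (splitAt⁻¹-↑ˡ eq) (at-view lower a)
  ... | inj₂ a = subst AtView (splitAt⁻¹-↑ʳ eq) (at-view upper a)

  toℕ-at : ∀ s (i : Fin m) → toℕ (at s i) ≡ offset m s + toℕ i
  toℕ-at lower i = toℕ-↑ˡ i m
  toℕ-at upper i = toℕ-↑ʳ m i

  liftPerm : Permutation′ m → Permutation′ (m + m)
  liftPerm π = ↔-trans +↔⊎ (↔-trans (π ⊎-↔ π) (↔-sym +↔⊎))

  liftPerm-at : ∀ (π : Permutation′ m) s a → liftPerm π ⟨$⟩ʳ at s a ≡ at s (π ⟨$⟩ʳ a)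
  liftPerm-at π lower a = cong (join m m ∘ Sum.map (π ⟨$⟩ʳ_) (π ⟨$⟩ʳ_)) (splitAt-↑ˡ m a m)
  liftPerm-at π upper a = cong (join m m ∘ Sum.map (π ⟨$⟩ʳ_) (π ⟨$⟩ʳ_)) (splitAt-↑ʳ m m a)

-- The 2-lift of H in which exactly the edges in X switch sheets.
module TwoLift {m : ℕ} (H : Graph m) (X : Fin m → Subset m)
  (X-sym : ∀ a b → b ∈ X a → a ∈ X b) (X⊆nbr : ∀ a → X a ⊆ nbr H a) where

  open Sheets m

  sheetNbr : Sheet → Fin m → Subset (m + m)
  sheetNbr lower a = (nbr H a ─ X a) ++ X a
  sheetNbr upper a = X a ++ (nbr H a ─ X a)

  liftNbr : Fin (m + m) → Subset (m + m)
  liftNbr u = [ sheetNbr lower , sheetNbr upper ]′ (splitAt m u)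

  liftNbr-at : ∀ s a → liftNbr (at s a) ≡ sheetNbr s a
  liftNbr-at lower a = cong [ sheetNbr lower , sheetNbr upper ]′ (splitAt-↑ˡ m a m)
  liftNbr-at upper a = cong [ sheetNbr lower , sheetNbr upper ]′ (splitAt-↑ʳ m m a)

  data LiftAdj : Sheet → Fin m → Sheet → Fin m → Set where
    along  : ∀ {s a b} → b ∈ nbr H a ─ X a → LiftAdj s a s b
    across : ∀ {s a b} → b ∈ X a → LiftAdj s a (other s) b

  liftAdj⇒∈ : ∀ {s a t b} → LiftAdj s a t b → at t b ∈ liftNbr (at s a)
  liftAdj⇒∈ {s} {a} {t} {b} adj = subst (at t b ∈_) (≡-sym (liftNbr-at s a)) (∈sheet adj)
    where
    ∈sheet : ∀ {s a t b} → LiftAdj s a t b → at t b ∈ sheetNbr s a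
    ∈sheet {lower} (along b∈)  = ↑ˡ∈++⁺ _ b∈
    ∈sheet {upper} (along b∈)  = ↑ʳ∈++⁺ _ b∈
    ∈sheet {lower} (across b∈) = ↑ʳ∈++⁺ _ b∈
    ∈sheet {upper} (across b∈) = ↑ˡ∈++⁺ _ b∈

  ∈⇒liftAdj : ∀ s a t b → at t b ∈ liftNbr (at s a) → LiftAdj s a t b
  ∈⇒liftAdj s a t b b∈ = fromSheet s t (subst (at t b ∈_) (liftNbr-at s a) b∈)
    where
    fromSheet : ∀ s t → at t b ∈ sheetNbr s a → LiftAdj s a t b
    fromSheet lower lower b∈ = along  (↑ˡ∈++⁻ _ b∈)
    fromSheet lower upper b∈ = across (↑ʳ∈++⁻ (nbr H a ─ X a) b∈)
    fromSheet upper lower b∈ = across (↑ˡ∈++⁻ _ b∈)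
    fromSheet upper upper b∈ = along  (↑ʳ∈++⁻ (X a) b∈)

  liftAdj-sym : ∀ {s a t b} → LiftAdj s a t b → LiftAdj t b s a
  liftAdj-sym {a = a} {b = b} (along b∈) =
    along (x∈p∧x∉q⇒x∈p─q (Graph.sym H a b (p─q⊆p _ _ b∈)) (λ a∈ → x∈p─q⇒x∉q _ _ b∈ (X-sym b a a∈)))
  liftAdj-sym {lower} {a} {b = b} (across b∈) = across (X-sym a b b∈)
  liftAdj-sym {upper} {a} {b = b} (across b∈) = across (X-sym a b b∈)

  liftAdj-irrefl : ∀ {s a} → ¬ LiftAdj s a s a
  liftAdj-irrefl {lower} {a} (along a∈) = irrefl H a (p─q⊆p _ _ a∈)
  liftAdj-irrefl {upper} {a} (along a∈) = irrefl H a (p─q⊆p _ _ a∈)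

  lift : Graph (m + m)
  lift = record { nbr = liftNbr ; sym = lift-sym ; irrefl = lift-irrefl }
    where
    lift-sym : ∀ u v → v ∈ liftNbr u → u ∈ liftNbr v
    lift-sym u v with view u | view v
    ... | at-view s a | at-view t b = liftAdj⇒∈ ∘ liftAdj-sym ∘ ∈⇒liftAdj s a t b
    lift-irrefl : ∀ u → u ∉ liftNbr u
    lift-irrefl u with view u
    ... | at-view s a = liftAdj-irrefl ∘ ∈⇒liftAdj s a s a

  lift-regular : ∀ {k} → Regular k H → Regular k lift
  lift-regular reg u with view u
  ... | at-view s a = trans (cong ∣_∣ (liftNbr-at s a)) (trans (∣sheetNbr∣ s) (reg a))
    where
    ∣sheetNbr∣ : ∀ s → ∣ sheetNbr s a ∣ ≡ ∣ nbr H a ∣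
    ∣sheetNbr∣ lower = trans (∣p++q∣≡∣p∣+∣q∣ (nbr H a ─ X a) (X a)) (q⊆p⇒∣p─q∣+∣q∣≡∣p∣ _ _ (X⊆nbr a))
    ∣sheetNbr∣ upper = trans (∣p++q∣≡∣p∣+∣q∣ (X a) (nbr H a ─ X a))
                     (trans (+-comm ∣ X a ∣ _) (q⊆p⇒∣p─q∣+∣q∣≡∣p∣ _ _ (X⊆nbr a)))

module Doubling {m : ℕ} (H : Graph m) (hH : HamCycle H) where

  open Sheets m

  pos : Fin m → ℕ
  pos a = toℕ (ord hH ⟨$⟩ʳ a)

  Closing : Fin m → Fin m → Set
  Closing a b = Wrap m (pos a) (pos b) ⊎ Wrap m (pos b) (pos a)

  closing? : ∀ a b → Dec (Closing a b)
  closing? a b = wrap? (pos a) (pos b) ⊎-dec wrap? (pos b) (pos a)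
    where
    wrap? : ∀ x y → Dec (Wrap m x y)
    wrap? x y = (suc x ≟ m) ×-dec (y ≟ 0)

  closingNbr : Fin m → Subset m
  closingNbr a = tabulate (λ b → does (closing? a b))

  ∈closingNbr⁺ : ∀ {a b} → Closing a b → b ∈ closingNbr a
  ∈closingNbr⁺ {a} {b} c = ∈-tabulate⁺ (λ b → does (closing? a b)) (dec-true (closing? a b) c)

  ∈closingNbr⁻ : ∀ {a b} → b ∈ closingNbr a → Closing a b
  ∈closingNbr⁻ {a} {b} b∈ = dec-true⁻ (closing? a b) (∈-tabulate⁻ (λ b → does (closing? a b)) b∈)

  closing⇒nbr : ∀ {a b} → Closing a b → b ∈ nbr H a
  closing⇒nbr {a} {b} c = edges hH a b (Sum.map inj₂ inj₂ c)

  succ⇒¬closing : ∀ {a b} → suc (pos a) ≡ pos b → ¬ Closing a b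
  succ⇒¬closing e (inj₁ (_ , pb≡0)) with () ← trans e pb≡0
  succ⇒¬closing e (inj₂ (sb≡m , pa≡0)) = contradiction (length hH) 3≰m
    where
    3≰m : ¬ 3 ≤ m
    3≰m 3≤m with s≤s (s≤s ()) ←
      subst (3 ≤_) (trans (≡-sym sb≡m) (cong suc (trans (≡-sym e) (cong suc pa≡0)))) 3≤m

  open TwoLift H closingNbr (λ _ _ → ∈closingNbr⁺ ∘ Sum.swap ∘ ∈closingNbr⁻)
    (λ _ → closing⇒nbr ∘ ∈closingNbr⁻) public

  liftOrd : Permutation′ (m + m)
  liftOrd = liftPerm (ord hH)

  liftPos-at : ∀ s a → toℕ (liftOrd ⟨$⟩ʳ at s a) ≡ offset m s + pos a
  liftPos-at s a = trans (cong toℕ (liftPerm-at (ord hH) s a)) (toℕ-at s (ord hH ⟨$⟩ʳ a))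

  liftNext⁺ : ∀ s a t b → Next (m + m) (offset m s + pos a) (offset m t + pos b) →
    Next (m + m) (toℕ (liftOrd ⟨$⟩ʳ at s a)) (toℕ (liftOrd ⟨$⟩ʳ at t b))
  liftNext⁺ s a t b = subst₂ (Next (m + m)) (≡-sym (liftPos-at s a)) (≡-sym (liftPos-at t b))

  liftNext⁻ : ∀ s a t b → Next (m + m) (toℕ (liftOrd ⟨$⟩ʳ at s a)) (toℕ (liftOrd ⟨$⟩ʳ at t b)) →
    Next (m + m) (offset m s + pos a) (offset m t + pos b)
  liftNext⁻ s a t b = subst₂ (Next (m + m)) (liftPos-at s a) (liftPos-at t b)

  liftNext⇒liftAdj : ∀ s a t b →
    Next (m + m) (toℕ (liftOrd ⟨$⟩ʳ at s a)) (toℕ (liftOrd ⟨$⟩ʳ at t b)) → LiftAdj s a t b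
  liftNext⇒liftAdj s a t b nx
    with next-double⁻ m s t (toℕ<n (ord hH ⟨$⟩ʳ a)) (toℕ<n (ord hH ⟨$⟩ʳ b)) (liftNext⁻ s a t b nx)
  ... | inj₁ (refl , e) =
    along (x∈p∧x∉q⇒x∈p─q (edges hH a b (inj₁ (inj₁ e))) (succ⇒¬closing e ∘ ∈closingNbr⁻))
  ... | inj₂ (refl , w) = across (∈closingNbr⁺ (inj₁ w))

  liftHam : HamCycle lift
  liftHam = record { ord = liftOrd ; length = ≤-trans (length hH) (m≤m+n m m) ; edges = lift-edges }
    where
    lift-edges : ∀ u v → CycEdge liftOrd u v → v ∈ nbr lift u
    lift-edges u v with view u | view v
    ... | at-view s a | at-view t b =
      [ liftAdj⇒∈ ∘ liftNext⇒liftAdj s a t b , liftAdj⇒∈ ∘ liftAdj-sym ∘ liftNext⇒liftAdj t b s a ]′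

  cycEdge-lift : ∀ s a b → CycEdge (ord hH) a b → CycEdge liftOrd (at s a) (at s b) ⊎ Closing a b
  cycEdge-lift s a b (inj₁ (inj₁ e)) = inj₁ (inj₁ (liftNext⁺ s a s b (next-along m s e)))
  cycEdge-lift s a b (inj₂ (inj₁ e)) = inj₁ (inj₂ (liftNext⁺ s b s a (next-along m s e)))
  cycEdge-lift s a b (inj₁ (inj₂ w)) = inj₂ (inj₁ w)
  cycEdge-lift s a b (inj₂ (inj₂ w)) = inj₂ (inj₂ w)

  closing-lift : ∀ s a b → Closing a b → CycEdge liftOrd (at s a) (at (other s) b)
  closing-lift s     a b (inj₁ w) = inj₁ (liftNext⁺ s a (other s) b (next-across m s w))
  closing-lift lower a b (inj₂ w) = inj₂ (liftNext⁺ upper b lower a (next-across m upper w))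
  closing-lift upper a b (inj₂ w) = inj₂ (liftNext⁺ lower b upper a (next-across m lower w))

  restrict : Sheet → Subset (m + m) → Subset m
  restrict s S = tabulate (λ b → lookup S (at s b))

  ∈restrict⁺ : ∀ s {S b} → at s b ∈ S → b ∈ restrict s S
  ∈restrict⁺ s {S} sb∈S = ∈-tabulate⁺ (λ b → lookup S (at s b)) ([]=⇒lookup sb∈S)

  ∈restrict⁻ : ∀ s {S b} → b ∈ restrict s S → at s b ∈ S
  ∈restrict⁻ s {S} {b} b∈ = lookup⇒[]= (at s b) S (∈-tabulate⁻ (λ b → lookup S (at s b)) b∈)

  restrict-indepDom : ∀ s S → IndepDom lift liftHam S →
    (∀ a b → Wrap m (pos a) (pos b) → at s a ∈ S → at s b ∈ S → ⊥) → IndepDom H hH (restrict s S)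
  restrict-indepDom s S (indep , dom) wrapFree = indep′ , dom′
    where
    indep′ : ∀ a b → a ∈ restrict s S → b ∈ restrict s S → ¬ CycEdge (ord hH) a b
    indep′ a b a∈ b∈ c with cycEdge-lift s a b c
    ... | inj₁ c′       = indep (at s a) (at s b) (∈restrict⁻ s a∈) (∈restrict⁻ s b∈) c′
    ... | inj₂ (inj₁ w) = wrapFree a b w (∈restrict⁻ s a∈) (∈restrict⁻ s b∈)
    ... | inj₂ (inj₂ w) = wrapFree b a w (∈restrict⁻ s b∈) (∈restrict⁻ s a∈)
    dom′ : ∀ b → b ∈ restrict s S ⊎ ∃ λ a → a ∈ restrict s S × b ∈ nbr H a × ¬ CycEdge (ord hH) a b
    dom′ b with dom (at s b)
    ... | inj₁ sb∈S = inj₁ (∈restrict⁺ s sb∈S)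
    ... | inj₂ (u , u∈S , sb∈ , ¬cyc) with view u
    ...   | at-view t a with ∈⇒liftAdj t a s b sb∈
    ...     | along b∈ = inj₂ (a , ∈restrict⁺ t u∈S , p─q⊆p _ _ b∈ ,
                                [ ¬cyc , x∈p─q⇒x∉q _ _ b∈ ∘ ∈closingNbr⁺ ]′ ∘ cycEdge-lift t a b)
    ...     | across b∈ = contradiction (closing-lift t a b (∈closingNbr⁻ b∈)) ¬cyc

  lift-noIndepDom : NoIndepDom H hH → NoIndepDom lift liftHam
  lift-noIndepDom noH (S , S-indepDom) =
    noH (restrict lower S , restrict-indepDom lower S S-indepDom lowerFree)
    where
    lowerFree : ∀ a b → Wrap m (pos a) (pos b) → at lower a ∈ S → at lower b ∈ S → ⊥
    lowerFree a _ w a∈S _ = noH (restrict upper S , restrict-indepDom upper S S-indepDom upperFree)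
      where
      upperFree : ∀ a′ b′ → Wrap m (pos a′) (pos b′) → at upper a′ ∈ S → at upper b′ ∈ S → ⊥
      upperFree _ b′ w′ _ b′∈S =
        proj₁ S-indepDom (at lower a) (at upper b′) a∈S b′∈S
          (closing-lift lower a b′ (inj₁ (proj₁ w , proj₂ w′)))

lemma2 : (k : ℕ) → 1 ≤ k →
    (∃ λ m → Σ (Graph m) λ H → Regular k H × Σ (HamCycle H) λ hH → NoIndepDom H hH) →
    ∀ (N : ℕ) → ∃ λ n → N < n × Σ (Graph n) λ G → Regular k G × Σ (HamCycle G) λ h → NoIndepDom G h
lemma2 k _ (m , H , H-reg , hH , noH) zero = m , ≤-trans (s≤s z≤n) (length hH) , H , H-reg , hH , noH
lemma2 k 1≤k base (suc N) with lemma2 k 1≤k base N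
... | n , N<n , G , G-reg , h , noG =
  n + n , ≤-trans (s≤s N<n) (m<m+n n (≤-<-trans z≤n N<n)) ,
  lift , lift-regular G-reg , liftHam , lift-noIndepDom noG
  where open Doubling G h
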